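{- Let $B$ be an $(n,n-1)$-blocker for a convex $n$-gon $C$ with vertices $0,\dots,n-1$ (indices mod $n$). If the ear-cover $(i-1,i+1)$ does not belong to $B$ and $\deg_B(i)=2$, then $B\setminus\{i\}$ is a minimum-sized blocker (i.e., a blocker with $n-3$ edges) for the convex $(n-1)$-gon $C\setminus\{i\}$.
   Context: A triangulation of a convex polygon is a maximal set of pairwise non-crossing diagonals. A blocker is a set of edges sharing an edge with every triangulation; the minimum size of a blocker for a convex $N$-gon is $N-2$. A blocker is saturated if removing any of its edges yields a non-blocker; an $(n,k)$-blocker is a saturated blocker with $k$ edges for a convex $n$-gon. An ear-cover is a diagonal $(i-1,i+1)$. $C\setminus\{i\}$ is the convex polygon obtained by deleting vertex $i$ (so $(i-1,i+1)$ becomes a side), and $B\setminus\{i\}$ is $B$ with all edges incident to $i$ and the edge $(i-1,i+1)$ removed. -}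

module Defs where

open import Data.Nat using (ℕ; zero; suc; _+_; _∸_; _<_; _≤_; _<?_; _≟_; NonZero)
open import Data.Nat.DivMod using (_%_)
open import Data.Product using (_×_; _,_; Σ; ∃; ∃-syntax)
open import Data.Product.Properties using (≡-dec)
open import Data.Sum using (_⊎_)
open import Data.List using (List; filter; length; map)
open import Data.List.Membership.Propositional using (_∈_; _∉_)
open import Data.List.Relation.Unary.All using (All)
open import Data.List.Relation.Unary.Unique.Propositional using (Unique)
open import Relation.Binary.PropositionalEquality using (_≡_; _≢_)
open import Relation.Nullary using (¬_; Dec; yes; no)
open import Relation.Nullary.Decidable using (_⊎-dec_; ¬?)
open import Relation.Binary using (DecidableEquality)

-- Vertices of the convex n-gon C are 0,…,n-1 in cyclic order.
-- An edge (segment between two distinct vertices) is represented as an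
-- ordered pair (a , b) of naturals with a < b < n.
Edge : Set
Edge = ℕ × ℕ

_≟E_ : DecidableEquality Edge
_≟E_ = ≡-dec _≟_ _≟_

-- A diagonal of the convex n-gon: an edge that is not a side,
-- i.e. a + 2 ≤ b < n and (a , b) ≠ (0 , n-1).
IsDiagonal : ℕ → Edge → Set
IsDiagonal n (a , b) = (suc (suc a) ≤ b) × (b < n) × ((suc b < n) ⊎ (0 < a))

-- Two diagonals cross (in their interiors) iff their endpoints interleave.
Cross : Edge → Edge → Set
Cross (a , b) (c , d) = (a < c × c < b × b < d) ⊎ (c < a × a < d × d < b)

IsTriangulation : ℕ → List Edge → Set
IsTriangulation n T =
  Unique T × All (IsDiagonal n) T
  × (∀ d e → d ∈ T → e ∈ T → ¬ Cross d e)
  × (∀ d → IsDiagonal n d → d ∉ T → ∃[ e ] (e ∈ T × Cross d e))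

IsBlocker : ℕ → List Edge → Set
IsBlocker n B =
  Unique B × All (IsDiagonal n) B
  × (∀ T → IsTriangulation n T → ∃[ e ] (e ∈ B × e ∈ T))

removeEdge : Edge → List Edge → List Edge
removeEdge e = filter (λ x → ¬? (x ≟E e))

IsSaturatedBlocker : ℕ → List Edge → Set
IsSaturatedBlocker n B = IsBlocker n B × (∀ e → e ∈ B → ¬ IsBlocker n (removeEdge e B))

Is-n-k-Blocker : ℕ → ℕ → List Edge → Set
Is-n-k-Blocker n k B = IsSaturatedBlocker n B × length B ≡ k

norm : ℕ → ℕ → Edge
norm a b with a <? b
... | yes _ = (a , b)
... | no _ = (b , a)

earCover : (n : ℕ) → .{{NonZero n}} → ℕ → Edge
earCover n i = norm ((i + (n ∸ 1)) % n) (suc i % n)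

Incident : ℕ → Edge → Set
Incident i (a , b) = (a ≡ i) ⊎ (b ≡ i)

incident? : (i : ℕ) → (e : Edge) → Dec (Incident i e)
incident? i (a , b) = (a ≟ i) ⊎-dec (b ≟ i)

degree : List Edge → ℕ → ℕ
degree B i = length (filter (incident? i) B)

-- Relabelling of the vertices of C \ {i} as 0,…,n-2 (order preserving).
relabelV : ℕ → ℕ → ℕ
relabelV i v with v <? i
... | yes _ = v
... | no _ = v ∸ 1

relabelE : ℕ → Edge → Edge
relabelE i (a , b) = (relabelV i a , relabelV i b)

-- B \ {i}: remove all edges incident to i and the edge (i-1,i+1), then view
-- the result as a set of edges of the (n-1)-gon C \ {i} (relabelled).
deleteVertex : (n : ℕ) → .{{NonZero n}} → ℕ → List Edge → List Edge
deleteVertex n i B =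
  map (relabelE i)
      (removeEdge (earCover n i) (filter (λ e → ¬? (incident? i e)) B))

{-# OPTIONS --safe #-}
-- Lift a triangulation T of C ∖ {i} to C by re-inserting the vertex i and adding
-- the ear cover (i-1, i+1): the result is a triangulation of C, since every
-- diagonal at i crosses the ear cover and no other diagonal does.  B meets it,
-- and not in the ear cover, so B ∖ {i} meets T.  Of the n - 1 edges of B, two
-- are incident to i and the ear cover is not among them, leaving n - 3.
module Submission where

open import Defs
open import Data.Nat using (ℕ; zero; suc; _+_; _<_; _≤_; _<?_; _≟_; z≤n; s≤s; z<s; NonZero)
open import Data.Nat.Properties
open import Data.Nat.DivMod using (_%_; m<n⇒m%n≡m; n%n≡0; [m+n]%n≡m%n)
open import Data.Product using (_×_; _,_; ∃-syntax; proj₁; proj₂)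
open import Data.Sum using (_⊎_; inj₁; inj₂; fromInj₁)
open import Data.Empty using (⊥-elim)
open import Data.List using (List; []; _∷_; filter; length; map)
open import Data.List.Properties using (length-map; filter-all; map-∘; map-id-local)
open import Data.List.Relation.Unary.All as All using (All; [])
import Data.List.Relation.Unary.All.Properties as All
open import Data.List.Relation.Unary.Any using (here; there)
open import Data.List.Relation.Unary.Unique.Propositional using (Unique)
import Data.List.Relation.Unary.Unique.Propositional.Properties as Unique
open import Data.List.Relation.Unary.AllPairs using ([]; _∷_)
open import Data.List.Membership.Propositional using (_∈_; _∉_)
open import Data.List.Membership.Propositional.Properties using (∈-filter⁺; ∈-filter⁻; ∈-map⁺; ∈-map⁻)
open import Relation.Binary.PropositionalEquality
open import Relation.Binary.Definitions using (tri<; tri≈; tri>)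
open import Relation.Nullary using (¬_; yes; no; contradiction)
open import Relation.Nullary.Decidable using (¬?)
open import Relation.Unary using (Pred; Decidable)
open import Function using (_∘_)

data Side : ℕ → Edge → Set where
  consecutive : ∀ {n a} → suc a < n → Side n (a , suc a)
  closing     : ∀ {n} → Side (suc n) (0 , n)

side⇒¬diagonal : ∀ {n e} → Side n e → ¬ IsDiagonal n e
side⇒¬diagonal (consecutive _) (a+2≤a+1 , _) = <-irrefl refl a+2≤a+1
side⇒¬diagonal closing (_ , _ , inj₁ n+1<n+1) = <-irrefl refl n+1<n+1

diagonal-or-side : ∀ {n a b} → a < b → b < n → IsDiagonal n (a , b) ⊎ Side n (a , b)
diagonal-or-side {n} {a} {b} a<b b<n with suc a ≟ b
... | yes refl = inj₂ (consecutive b<n)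
... | no a+1≢b with m≤n⇒m<n∨m≡n b<n | a
...   | inj₁ b+1<n | _     = inj₁ (≤∧≢⇒< a<b a+1≢b , b<n , inj₁ b+1<n)
...   | inj₂ _     | suc _ = inj₁ (≤∧≢⇒< a<b a+1≢b , b<n , inj₂ z<s)
...   | inj₂ refl  | zero  = inj₂ closing

Cross-sym : ∀ {e f} → Cross e f → Cross f e
Cross-sym (inj₁ c) = inj₂ c
Cross-sym (inj₂ c) = inj₁ c

Cross-irrefl : ∀ {e} → ¬ Cross e e
Cross-irrefl (inj₁ (a<a , _)) = <-irrefl refl a<a
Cross-irrefl (inj₂ (a<a , _)) = <-irrefl refl a<a

¬IsDiagonal-triangle : ∀ d → ¬ IsDiagonal 3 d
¬IsDiagonal-triangle (zero , 2) = side⇒¬diagonal closing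
¬IsDiagonal-triangle (suc a , 2) (s≤s (s≤s ()) , _)
¬IsDiagonal-triangle (a , suc (suc (suc b))) (_ , s≤s (s≤s (s≤s ())) , _)
¬IsDiagonal-triangle (a , 0) (() , _)
¬IsDiagonal-triangle (a , 1) (s≤s () , _)

¬IsBlocker-triangle : ∀ {B} → ¬ IsBlocker 3 B
¬IsBlocker-triangle (_ , _ , meets)
  with meets [] ([] , [] , (λ _ _ ()) , λ d d-diag _ → ⊥-elim (¬IsDiagonal-triangle d d-diag))
... | _ , _ , ()

-- Re-inserting a deleted vertex (the ℕ-analogue of Data.Fin.punchIn)

punchIn : ℕ → ℕ → ℕ
punchIn i v with v <? i
... | yes _ = v
... | no _  = suc v

punchInE : ℕ → Edge → Edge
punchInE i (a , b) = (punchIn i a , punchIn i b)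

punchIn-< : ∀ {i v} → v < i → punchIn i v ≡ v
punchIn-< {i} {v} v<i with v <? i
... | yes _  = refl
... | no v≮i = contradiction v<i v≮i

punchIn-≥ : ∀ {i v} → i ≤ v → punchIn i v ≡ suc v
punchIn-≥ {i} {v} i≤v with v <? i
... | yes v<i = contradiction i≤v (<⇒≱ v<i)
... | no _    = refl

relabelV-< : ∀ {i v} → v < i → relabelV i v ≡ v
relabelV-< {i} {v} v<i with v <? i
... | yes _  = refl
... | no v≮i = contradiction v<i v≮i

relabelV-≥ : ∀ {i v} → i ≤ v → relabelV i (suc v) ≡ v
relabelV-≥ {i} {v} i≤v with suc v <? i
... | yes v+1<i = contradiction i≤v (<⇒≱ (<-trans (n<1+n v) v+1<i))
... | no _      = refl

punchIn-mono-< : ∀ i {x y} → x < y → punchIn i x < punchIn i y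
punchIn-mono-< i {x} {y} x<y with x <? i | y <? i
... | yes _  | yes _   = x<y
... | yes _  | no _    = m≤n⇒m≤1+n x<y
... | no x≮i | yes y<i = contradiction (<-trans x<y y<i) x≮i
... | no _   | no _    = s≤s x<y

punchIn-cancel-< : ∀ i {x y} → punchIn i x < punchIn i y → x < y
punchIn-cancel-< i {x} {y} lt with <-cmp x y
... | tri< x<y _ _    = x<y
... | tri≈ _ refl _   = contradiction lt (<-irrefl refl)
... | tri> _ _ y<x    = contradiction lt (<-asym (punchIn-mono-< i y<x))

punchInᵢ≢i : ∀ i v → punchIn i v ≢ i
punchInᵢ≢i i v eq with v <? i
... | yes v<i = <-irrefl eq v<i
... | no v≮i  = v≮i (≤-reflexive eq)

v≤punchIn : ∀ i v → v ≤ punchIn i v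
v≤punchIn i v with v <? i
... | yes _ = ≤-refl
... | no _  = n≤1+n v

punchIn≤1+v : ∀ i v → punchIn i v ≤ suc v
punchIn≤1+v i v with v <? i
... | yes _ = n≤1+n v
... | no _  = ≤-refl

punchIn-<⁻ : ∀ {i n v} → i ≤ n → punchIn i v < suc n → v < n
punchIn-<⁻ {i} {n} {v} i≤n lt with v <? i
... | yes v<i = <-≤-trans v<i i≤n
... | no _    = ≤-pred lt

punchIn-gap : ∀ {i a} → suc (suc (punchIn i a)) ≤ punchIn i (suc a) → i ≡ suc a
punchIn-gap {i} {a} gap with a <? i | suc a <? i
... | yes _   | yes _     = contradiction gap (<-irrefl refl)
... | yes a<i | no a+1≮i  = ≤-antisym (≮⇒≥ a+1≮i) a<i
... | no a≮i  | yes a+1<i = contradiction (<-trans (n<1+n a) a+1<i) a≮i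
... | no _    | no _      = contradiction gap (<-irrefl refl)

relabelV-punchIn : ∀ i v → relabelV i (punchIn i v) ≡ v
relabelV-punchIn i v with v <? i
... | yes v<i = relabelV-< v<i
... | no v≮i  = relabelV-≥ (≮⇒≥ v≮i)

punchIn-relabelV : ∀ {i v} → v ≢ i → punchIn i (relabelV i v) ≡ v
punchIn-relabelV {i} {v} v≢i with v <? i
... | yes v<i = punchIn-< v<i
punchIn-relabelV {i} {zero}  v≢i | no 0≮i  = contradiction (≤∧≢⇒< z≤n v≢i) 0≮i
punchIn-relabelV {i} {suc v} v≢i | no v+1≮i = punchIn-≥ (≤-pred (≤∧≢⇒< (≮⇒≥ v+1≮i) (v≢i ∘ sym)))

relabelE-punchInE : ∀ i e → relabelE i (punchInE i e) ≡ e
relabelE-punchInE i (a , b) = cong₂ _,_ (relabelV-punchIn i a) (relabelV-punchIn i b)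

punchInE-relabelE : ∀ {i e} → ¬ Incident i e → punchInE i (relabelE i e) ≡ e
punchInE-relabelE {i} {a , b} avoids =
  cong₂ _,_ (punchIn-relabelV (avoids ∘ inj₁)) (punchIn-relabelV (avoids ∘ inj₂))

punchInE-injective : ∀ i {e f} → punchInE i e ≡ punchInE i f → e ≡ f
punchInE-injective i {e} {f} eq =
  trans (sym (relabelE-punchInE i e)) (trans (cong (relabelE i) eq) (relabelE-punchInE i f))

punchInE-avoids : ∀ i e → ¬ Incident i (punchInE i e)
punchInE-avoids i (a , b) (inj₁ eq) = punchInᵢ≢i i a eq
punchInE-avoids i (a , b) (inj₂ eq) = punchInᵢ≢i i b eq

Cross-punchIn⁺ : ∀ i {e f} → Cross e f → Cross (punchInE i e) (punchInE i f)
Cross-punchIn⁺ i (inj₁ (p , q , r)) = inj₁ (punchIn-mono-< i p , punchIn-mono-< i q , punchIn-mono-< i r)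
Cross-punchIn⁺ i (inj₂ (p , q , r)) = inj₂ (punchIn-mono-< i p , punchIn-mono-< i q , punchIn-mono-< i r)

Cross-punchIn⁻ : ∀ i {e f} → Cross (punchInE i e) (punchInE i f) → Cross e f
Cross-punchIn⁻ i (inj₁ (p , q , r)) = inj₁ (punchIn-cancel-< i p , punchIn-cancel-< i q , punchIn-cancel-< i r)
Cross-punchIn⁻ i (inj₂ (p , q , r)) = inj₂ (punchIn-cancel-< i p , punchIn-cancel-< i q , punchIn-cancel-< i r)

punchIn-isDiagonal : ∀ i {n e} → IsDiagonal n e → IsDiagonal (suc n) (punchInE i e)
punchIn-isDiagonal i {n} {a , b} (a+2≤b , b<n , outer) =
  ≤-trans (s≤s (punchIn-mono-< i (n<1+n a))) (punchIn-mono-< i a+2≤b) ,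
  s≤s (≤-trans (punchIn≤1+v i b) b<n) ,
  lift-outer outer
  where
  lift-outer : (suc b < n) ⊎ (0 < a) → (suc (punchIn i b) < suc n) ⊎ (0 < punchIn i a)
  lift-outer (inj₁ b+1<n) = inj₁ (s≤s (≤-trans (s≤s (punchIn≤1+v i b)) b+1<n))
  lift-outer (inj₂ 0<a)   = inj₂ (≤-trans 0<a (v≤punchIn i a))

norm-< : ∀ {a b} → a < b → norm a b ≡ (a , b)
norm-< {a} {b} a<b with a <? b
... | yes _  = refl
... | no a≮b = contradiction a<b a≮b

norm-> : ∀ {a b} → b < a → norm a b ≡ (b , a)
norm-> {a} {b} b<a with a <? b
... | yes a<b = contradiction b<a (<-asym a<b)
... | no _    = refl

data Position (m : ℕ) : ℕ → Set where
  first : Position m 0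
  last  : Position m (2 + m)
  inner : ∀ j → 2 + j < 3 + m → Position m (suc j)

position : ∀ {m i} → i < 3 + m → Position m i
position {m} {zero}  _ = first
position {m} {suc j} i<n with suc j ≟ 2 + m
... | yes refl = last
... | no i≢n-1 = inner j (s≤s (≤∧≢⇒< (≤-pred i<n) i≢n-1))

position-≤ : ∀ {m i} → Position m i → i ≤ 2 + m
position-≤ first           = z≤n
position-≤ last            = ≤-refl
position-≤ (inner _ j+2<n) = <⇒≤ (≤-pred j+2<n)

earCoverOf : ∀ {m i} → Position m i → Edge
earCoverOf {m} first     = (1 , 2 + m)
earCoverOf {m} last      = (0 , 1 + m)
earCoverOf (inner j _)   = (j , 2 + j)

earCover-position : ∀ {m i} (p : Position m i) → earCover (3 + m) i ≡ earCoverOf p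
earCover-position {m} first =
  trans (cong₂ norm (m<n⇒m%n≡m {n = 3 + m} (n<1+n (2 + m))) (m<n⇒m%n≡m {n = 3 + m} {m = 1} (s≤s (s≤s z≤n))))
        (norm-> (s≤s (s≤s z≤n)))
earCover-position {m} last = trans (cong₂ norm previous (n%n≡0 (3 + m))) (norm-> z<s)
  where
  open ≡-Reasoning
  previous : (2 + m + (2 + m)) % (3 + m) ≡ 1 + m
  previous = begin
    (2 + m + (2 + m)) % (3 + m) ≡⟨ cong (_% (3 + m)) (sym (+-suc (1 + m) (2 + m))) ⟩
    (1 + m + (3 + m)) % (3 + m) ≡⟨ [m+n]%n≡m%n (1 + m) (3 + m) ⟩
    (1 + m) % (3 + m)           ≡⟨ m<n⇒m%n≡m (m≤n⇒m≤1+n (n<1+n (1 + m))) ⟩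
    1 + m                       ∎
earCover-position {m} (inner j j+2<n) =
  trans (cong₂ norm previous (m<n⇒m%n≡m j+2<n)) (norm-< (<-trans (n<1+n j) (n<1+n (suc j))))
  where
  open ≡-Reasoning
  previous : (suc j + (2 + m)) % (3 + m) ≡ j
  previous = begin
    (suc j + (2 + m)) % (3 + m) ≡⟨ cong (_% (3 + m)) (sym (+-suc j (2 + m))) ⟩
    (j + (3 + m)) % (3 + m)     ≡⟨ [m+n]%n≡m%n j (3 + m) ⟩
    j % (3 + m)                 ≡⟨ m<n⇒m%n≡m (<-trans (n<1+n j) (<-trans (n<1+n (suc j)) j+2<n)) ⟩
    j                           ∎

earCover-isDiagonal : ∀ {k i} (p : Position (suc k) i) → IsDiagonal (4 + k) (earCoverOf p)
earCover-isDiagonal first = s≤s (s≤s (s≤s z≤n)) , ≤-refl , inj₂ z<s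
earCover-isDiagonal last  = s≤s (s≤s z≤n) , m≤n⇒m≤1+n (n<1+n _) , inj₁ ≤-refl
earCover-isDiagonal (inner zero j+2<n)    = ≤-refl , j+2<n , inj₁ (s≤s (s≤s (s≤s (s≤s z≤n))))
earCover-isDiagonal (inner (suc j) j+2<n) = ≤-refl , j+2<n , inj₂ z<s

incident-crosses-earCover : ∀ {m i} (p : Position m i) {e} →
  IsDiagonal (3 + m) e → Incident i e → Cross e (earCoverOf p)
incident-crosses-earCover first {.0 , b} (2≤b , _ , inj₁ b+1<n) (inj₁ refl) = inj₁ (z<s , 2≤b , ≤-pred b+1<n)
incident-crosses-earCover first {.0 , b} (_ , _ , inj₂ ()) (inj₁ refl)
incident-crosses-earCover first {a , .0} (() , _) (inj₂ refl)
incident-crosses-earCover last {.(2 + _) , b} (a+2≤b , b<n , _) (inj₁ refl) =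
  contradiction b<n (<⇒≱ (≤-trans a+2≤b (n≤1+n _)))
incident-crosses-earCover last {a , .(2 + _)} (a+2≤b , _ , inj₂ 0<a) (inj₂ refl) =
  inj₂ (0<a , ≤-pred a+2≤b , n<1+n _)
incident-crosses-earCover last {a , .(2 + _)} (_ , _ , inj₁ n<n) (inj₂ refl) = contradiction n<n (<-irrefl refl)
incident-crosses-earCover (inner j _) {.(suc j) , b} (a+2≤b , _) (inj₁ refl) =
  inj₂ (n<1+n j , n<1+n (suc j) , a+2≤b)
incident-crosses-earCover (inner j _) {a , .(suc j)} (a+2≤b , _) (inj₂ refl) =
  inj₁ (≤-pred a+2≤b , n<1+n j , n<1+n (suc j))

earCover-crosses-only-incident : ∀ {m i} (p : Position m i) {c d} →
  ¬ Incident i (c , d) → d < 3 + m → ¬ Cross (earCoverOf p) (c , d)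
earCover-crosses-only-incident first avoids d<n (inj₁ (_ , _ , n-1<d)) = <⇒≱ d<n n-1<d
earCover-crosses-only-incident first avoids d<n (inj₂ (s≤s z≤n , _)) = avoids (inj₁ refl)
earCover-crosses-only-incident last avoids d<n (inj₁ (_ , _ , n-2<d)) =
  avoids (inj₂ (≤-antisym (≤-pred d<n) n-2<d))
earCover-crosses-only-incident (inner j _) avoids d<n (inj₁ (j<c , c<j+2 , _)) =
  avoids (inj₁ (≤-antisym (≤-pred c<j+2) j<c))
earCover-crosses-only-incident (inner j _) avoids d<n (inj₂ (_ , j<d , d<j+2)) =
  avoids (inj₂ (≤-antisym (≤-pred d<j+2) j<d))

relabel-earCover-side : ∀ {m i} (p : Position m i) → Side (2 + m) (relabelE i (earCoverOf p))
relabel-earCover-side {m} first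
  rewrite relabelV-≥ {0} {0} z≤n | relabelV-≥ {0} {1 + m} z≤n = closing
relabel-earCover-side {m} last
  rewrite relabelV-< {2 + m} {0} z<s | relabelV-< {2 + m} {1 + m} (n<1+n _) = closing
relabel-earCover-side (inner j j+2<n)
  rewrite relabelV-< {suc j} {j} (n<1+n j) | relabelV-≥ {suc j} {suc j} ≤-refl =
  consecutive (≤-pred j+2<n)

side-punchIn-diagonal⇒earCover : ∀ {m i} (p : Position m i) {e} → Side (2 + m) e →
  IsDiagonal (3 + m) (punchInE i e) → punchInE i e ≡ earCoverOf p
side-punchIn-diagonal⇒earCover p (consecutive a+1<n) diag with punchIn-gap (proj₁ diag)
side-punchIn-diagonal⇒earCover first (consecutive _) diag | ()
side-punchIn-diagonal⇒earCover last (consecutive n-1<n) diag | refl = contradiction n-1<n (<-irrefl refl)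
side-punchIn-diagonal⇒earCover (inner j _) (consecutive _) diag | refl =
  cong₂ _,_ (punchIn-< (n<1+n j)) (punchIn-≥ ≤-refl)
side-punchIn-diagonal⇒earCover {m} first closing diag =
  cong₂ _,_ (punchIn-≥ {0} {0} z≤n) (punchIn-≥ {0} {1 + m} z≤n)
side-punchIn-diagonal⇒earCover {m} last closing diag =
  cong₂ _,_ (punchIn-< {2 + m} {0} z<s) (punchIn-< {2 + m} {1 + m} (n<1+n _))
side-punchIn-diagonal⇒earCover {m} (inner j j+2<n) closing diag
  rewrite punchIn-< {suc j} {0} z<s | punchIn-≥ {suc j} {1 + m} (≤-pred (≤-pred j+2<n)) =
  contradiction diag (side⇒¬diagonal closing)

punchIn-diagonal≢earCover : ∀ {m i} (p : Position m i) {e} →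
  IsDiagonal (2 + m) e → punchInE i e ≢ earCoverOf p
punchIn-diagonal≢earCover {m} {i} p {e} diag eq =
  side⇒¬diagonal (subst (Side (2 + m)) relabel-earCover≡e (relabel-earCover-side p)) diag
  where
  relabel-earCover≡e : relabelE i (earCoverOf p) ≡ e
  relabel-earCover≡e = trans (cong (relabelE i) (sym eq)) (relabelE-punchInE i e)

isDiagonal-punchIn⁻ : ∀ {m i} (p : Position m i) {e} →
  IsDiagonal (3 + m) (punchInE i e) → punchInE i e ≢ earCoverOf p → IsDiagonal (2 + m) e
isDiagonal-punchIn⁻ {m} {i} p {a , b} diag ≢earCover =
  fromInj₁ (λ side → contradiction (side-punchIn-diagonal⇒earCover p side diag) ≢earCover)
           (diagonal-or-side a<b b<n-1)
  where
  a<b : a < b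
  a<b = punchIn-cancel-< i (≤-trans (n≤1+n _) (proj₁ diag))
  b<n-1 : b < 2 + m
  b<n-1 = punchIn-<⁻ (position-≤ p) (proj₁ (proj₂ diag))

-- Lifting a triangulation of C ∖ {i} to C

module _ {k i : ℕ} (p : Position (suc k) i) {T : List Edge} (T-tri : IsTriangulation (3 + k) T) where

  private
    ear = earCoverOf p
    lifted = map (punchInE i) T

    T-unique = proj₁ T-tri
    T-diagonal = All.lookup (proj₁ (proj₂ T-tri))
    T-noncrossing = proj₁ (proj₂ (proj₂ T-tri))
    T-maximal = proj₂ (proj₂ (proj₂ T-tri))

    ear∉lifted : ∀ {x} → x ∈ lifted → ear ≢ x
    ear∉lifted x∈ ear≡x with ∈-map⁻ (punchInE i) x∈
    ... | e , e∈T , refl = punchIn-diagonal≢earCover p (T-diagonal e∈T) (sym ear≡x)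

    ear-crosses-no-lifted : ∀ {x} → x ∈ lifted → ¬ Cross ear x
    ear-crosses-no-lifted x∈ with ∈-map⁻ (punchInE i) x∈
    ... | e , e∈T , refl =
      earCover-crosses-only-incident p (punchInE-avoids i e)
        (proj₁ (proj₂ (punchIn-isDiagonal i (T-diagonal e∈T))))

    noncrossing : ∀ x y → x ∈ ear ∷ lifted → y ∈ ear ∷ lifted → ¬ Cross x y
    noncrossing _ _ (here refl) (here refl) = Cross-irrefl
    noncrossing _ _ (here refl) (there y∈) = ear-crosses-no-lifted y∈
    noncrossing _ _ (there x∈) (here refl) = ear-crosses-no-lifted x∈ ∘ Cross-sym
    noncrossing _ _ (there x∈) (there y∈) cross with ∈-map⁻ (punchInE i) x∈ | ∈-map⁻ (punchInE i) y∈
    ... | e , e∈T , refl | f , f∈T , refl = T-noncrossing e f e∈T f∈T (Cross-punchIn⁻ i cross)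

    Crossed : Edge → Set
    Crossed x = ∃[ y ] (y ∈ ear ∷ lifted × Cross x y)

    lifted-crossed : ∀ e {x} → punchInE i e ≡ x → IsDiagonal (4 + k) x → x ∉ ear ∷ lifted → Crossed x
    lifted-crossed e refl diag e∉ with T-maximal e (isDiagonal-punchIn⁻ p diag (e∉ ∘ here))
                                              (e∉ ∘ there ∘ ∈-map⁺ (punchInE i))
    ... | y , y∈T , cross = punchInE i y , there (∈-map⁺ (punchInE i) y∈T) , Cross-punchIn⁺ i cross

    maximal : ∀ x → IsDiagonal (4 + k) x → x ∉ ear ∷ lifted → Crossed x
    maximal x diag x∉ with incident? i x
    ... | yes incident = ear , here refl , incident-crosses-earCover p diag incident
    ... | no avoids = lifted-crossed (relabelE i x) (punchInE-relabelE avoids) diag x∉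

  liftTriangulation : IsTriangulation (4 + k) (earCoverOf p ∷ map (punchInE i) T)
  liftTriangulation =
    (All.tabulate ear∉lifted ∷ Unique.map⁺ (punchInE-injective i) T-unique) ,
    (earCover-isDiagonal p All.∷ All.map⁺ (All.map (punchIn-isDiagonal i) (proj₁ (proj₂ T-tri)))) ,
    noncrossing , maximal

avoiding : ℕ → List Edge → List Edge
avoiding i = filter (λ e → ¬? (incident? i e))

deleteVertex-≡ : ∀ {n i B} .{{_ : NonZero n}} →
  earCover n i ∉ B → deleteVertex n i B ≡ map (relabelE i) (avoiding i B)
deleteVertex-≡ {n} {i} {B} ear∉B =
  cong (map (relabelE i)) (filter-all (λ x → ¬? (x ≟E earCover n i)) (All.tabulate ≢ear))
  where
  ≢ear : ∀ {x} → x ∈ avoiding i B → x ≢ earCover n i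
  ≢ear x∈ refl = ear∉B (proj₁ (∈-filter⁻ (λ e → ¬? (incident? i e)) x∈))

length-filter-split : ∀ {a p} {A : Set a} {P : Pred A p} (P? : Decidable P) xs →
  length (filter P? xs) + length (filter (λ x → ¬? (P? x)) xs) ≡ length xs
length-filter-split P? [] = refl
length-filter-split P? (x ∷ xs) with P? x
... | yes _ = cong suc (length-filter-split P? xs)
... | no _  = trans (+-suc _ _) (cong suc (length-filter-split P? xs))

length-deleteVertex : ∀ {n i B} .{{_ : NonZero n}} →
  earCover n i ∉ B → degree B i + length (deleteVertex n i B) ≡ length B
length-deleteVertex {n} {i} {B} ear∉B = begin
  degree B i + length (deleteVertex n i B)          ≡⟨ cong (λ D → degree B i + length D) (deleteVertex-≡ ear∉B) ⟩
  degree B i + length (map (relabelE i) (avoiding i B)) ≡⟨ cong (degree B i +_) (length-map (relabelE i) (avoiding i B)) ⟩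
  degree B i + length (avoiding i B)                ≡⟨ length-filter-split (incident? i) B ⟩
  length B                                          ∎
  where open ≡-Reasoning

module _ {k i : ℕ} {B : List Edge} (p : Position (suc k) i)
         (B-blocker : IsBlocker (4 + k) B) (ear∉B : earCoverOf p ∉ B) where

  private
    B⁻ = map (relabelE i) (avoiding i B)

    ∈-avoiding⁻ : ∀ {x} → x ∈ avoiding i B → x ∈ B × ¬ Incident i x
    ∈-avoiding⁻ = ∈-filter⁻ (λ e → ¬? (incident? i e))

    unique : Unique B⁻
    unique = Unique.map⁻ (subst Unique (sym punchIn-relabel) (Unique.filter⁺ _ (proj₁ B-blocker)))
      where
      punchIn-relabel : map (punchInE i) B⁻ ≡ avoiding i B
      punchIn-relabel = trans (sym (map-∘ (avoiding i B)))
        (map-id-local (All.tabulate (λ x∈ → punchInE-relabelE (proj₂ (∈-avoiding⁻ x∈)))))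

    lowered-diagonal : ∀ e {y} → punchInE i e ≡ y → y ∈ B → IsDiagonal (3 + k) e
    lowered-diagonal e refl e∈B =
      isDiagonal-punchIn⁻ p (All.lookup (proj₁ (proj₂ B-blocker)) e∈B) (λ eq → ear∉B (subst (_∈ B) eq e∈B))

    diagonal : ∀ {x} → x ∈ B⁻ → IsDiagonal (3 + k) x
    diagonal x∈ with ∈-map⁻ (relabelE i) x∈
    ... | y , y∈ , refl with ∈-avoiding⁻ y∈
    ... | y∈B , avoids = lowered-diagonal (relabelE i y) (punchInE-relabelE avoids) y∈B

    meets : ∀ T → IsTriangulation (3 + k) T → ∃[ e ] (e ∈ B⁻ × e ∈ T)
    meets T T-tri with proj₂ (proj₂ B-blocker) _ (liftTriangulation p T-tri)
    ... | _ , ear∈B , here refl = contradiction ear∈B ear∉B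
    ... | _ , x∈B , there x∈lifted with ∈-map⁻ (punchInE i) x∈lifted
    ...   | e , e∈T , refl =
      e , subst (_∈ B⁻) (relabelE-punchInE i e)
            (∈-map⁺ (relabelE i) (∈-filter⁺ (λ f → ¬? (incident? i f)) x∈B (punchInE-avoids i e))) ,
      e∈T

  relabel-avoiding-isBlocker : IsBlocker (3 + k) B⁻
  relabel-avoiding-isBlocker = unique , All.tabulate diagonal , meets

deleteVertex-isBlocker : ∀ {k i B} → i < 4 + k → IsBlocker (4 + k) B → earCover (4 + k) i ∉ B →
  IsBlocker (3 + k) (deleteVertex (4 + k) i B)
deleteVertex-isBlocker {k} {i} {B} i<n B-blocker ear∉B =
  subst (IsBlocker (3 + k)) (sym (deleteVertex-≡ ear∉B))
    (relabel-avoiding-isBlocker p B-blocker (subst (_∉ B) (earCover-position p) ear∉B))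
  where
  p = position i<n

mainTheorem12 : (m : ℕ) → (i : ℕ) → i < 3 + m → (B : List Edge)
    → Is-n-k-Blocker (3 + m) (2 + m) B
    → earCover (3 + m) i ∉ B
    → degree B i ≡ 2
    → IsBlocker (2 + m) (deleteVertex (3 + m) i B)
      × length (deleteVertex (3 + m) i B) ≡ m
mainTheorem12 zero i i<n B ((B-blocker , _) , _) ear∉B deg≡2 = ⊥-elim (¬IsBlocker-triangle B-blocker)
mainTheorem12 (suc k) i i<n B ((B-blocker , _) , |B|≡n-1) ear∉B deg≡2 =
  deleteVertex-isBlocker i<n B-blocker ear∉B , +-cancelˡ-≡ 2 _ _ 2+|B⁻|≡n-1
  where
  open ≡-Reasoning
  2+|B⁻|≡n-1 : 2 + length (deleteVertex (4 + k) i B) ≡ 2 + suc k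
  2+|B⁻|≡n-1 = begin
    2 + length (deleteVertex (4 + k) i B)          ≡⟨ cong (_+ length (deleteVertex (4 + k) i B)) deg≡2 ⟨
    degree B i + length (deleteVertex (4 + k) i B) ≡⟨ length-deleteVertex ear∉B ⟩
    length B                                       ≡⟨ |B|≡n-1 ⟩
    2 + suc k                                      ∎
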